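{- Let $m\ge1$, $r,s\ge0$ be integers, let $p$ be a prime number, and let $r'\in\{0,1,\dots,p-1\}$ with $r'\equiv r\pmod p$. Then, modulo $p\mathbb{Z}_p[x]$, $$(x+1)^{s+1}\left(\mathcal{F}_{m(p-1)}(x;r,s)-s!\right)\equiv-(s-r')_s\,(x+1)^{r'}x^{p-r'}\quad\text{if } r'\neq0,$$ $$(x+1)^{s+1}\left(\mathcal{F}_{m(p-1)}(x;r,s)-s!\right)\equiv-s!\,(x^p+1)\quad\text{if } r'=0.$$
   Context: $(\alpha)_j=\alpha(\alpha-1)\cdots(\alpha-j+1)$ for $j\ge1$, $(\alpha)_0=1$. ${n\brace k}_r$ is the $r$-Stirling number of the second kind (partitions of $\{1,\dots,n\}$ into $k$ nonempty blocks with $1,\dots,r$ in distinct blocks), and $\mathcal{F}_n(x;r,s)=\sum_{k=0}^n {n+r\brace k+r}_r (k+s)!\,x^k$. Congruence modulo $p\mathbb{Z}_p[x]$ means coefficientwise congruence modulo $p$. -}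

module Defs where

open import Data.Bool using (Bool; true; false; if_then_else_; _∧_)
open import Data.Nat as ℕ using (ℕ; zero; suc; _≤ᵇ_; _≡ᵇ_; _!; _∸_)
open import Data.Integer using (ℤ; +_; _+_; _-_; _*_; 0ℤ; 1ℤ)
open import Data.Integer.Divisibility using (_∣_)

-- r-Stirling numbers of the second kind  {n brace k}_r, via the standard
-- recurrence:  {n k}_r = 0 if n < r,  = [k = r] if n = r,
-- and for n ≥ r:  {n+1, k+1}_r = (k+1) {n, k+1}_r + {n, k}_r ,  {n+1, 0}_r = 0.
rStirling : ℕ → ℕ → ℕ → ℕ
rStirling r zero k = if (r ≡ᵇ 0) ∧ (k ≡ᵇ 0) then 1 else 0
rStirling r (suc n) zero = 0
rStirling r (suc n) (suc k) =
  if suc n ≤ᵇ r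
  then (if (suc n ≡ᵇ r) ∧ (suc k ≡ᵇ r) then 1 else 0)
  else (suc k ℕ.* rStirling r n (suc k) ℕ.+ rStirling r n k)

-- Polynomials with integer coefficients, as coefficient sequences
-- (coefficient of x^k at index k).
Poly : Set
Poly = ℕ → ℤ

sumBelow : (ℕ → ℤ) → ℕ → ℤ
sumBelow f zero = 0ℤ
sumBelow f (suc n) = sumBelow f n + f n

_+P_ : Poly → Poly → Poly
(f +P g) k = f k + g k

_-P_ : Poly → Poly → Poly
(f -P g) k = f k - g k

_*P_ : Poly → Poly → Poly
(f *P g) k = sumBelow (λ i → f i * g (k ∸ i)) (suc k)

C : ℤ → Poly
C c zero = c
C c (suc k) = 0ℤ

X^ : ℕ → Poly
X^ n k = if n ≡ᵇ k then 1ℤ else 0ℤ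

_^P_ : Poly → ℕ → Poly
f ^P zero = C 1ℤ
f ^P suc n = f *P (f ^P n)

X+1 : Poly
X+1 = X^ 1 +P C 1ℤ

F : ℕ → ℕ → ℕ → Poly
F n r s k = if k ≤ᵇ n then + (rStirling r (n ℕ.+ r) (k ℕ.+ r) ℕ.* (k ℕ.+ s) !) else 0ℤ

falling : ℤ → ℕ → ℤ
falling α zero = 1ℤ
falling α (suc j) = falling α j * (α - + j)

_≡P_[mod_] : Poly → Poly → ℕ → Set
f ≡P g [mod p ] = ∀ k → (+ p) ∣ (f k - g k)

-- Write H_n = (x+1)^{s+1} F_n(x; r, s).  The r-Stirling recurrence reads
-- F_{n+1} = θ_{s+1} F_n for the operator θ_c = x(1+x) d/dx + r + c·x, and
-- (x+1) θ_{c+1} = θ_c (x+1); hence H_{n+1} = θ_0 H_n and H_0 = s! (x+1)^{s+1}.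
-- The polynomials w_j = x^j (x+1)^{p-j} satisfy θ_0 w_j = (j+r) w_j + p·x·w_j,
-- so they are eigenvectors modulo p.  For s < p, with N = p - s - 1,
--   (x+1)^{s+1} = Σ_{j ≤ N} (-1)^j C(N,j) w_j      (expand ((x+1) - x)^N),
-- hence H_n ≡ Σ_j α_j (j+r)^n w_j with α_j = s! (-1)^j C(N,j).  At
-- n = m(p-1) Fermat's little theorem turns every (j+r)^n into 1 except at
-- the unique j = c < p with p | c + r (c = p - r′, or c = 0 if r′ = 0), so
-- H_n - H_0 ≡ -α_c w_c.  Finally α_c ≡ (s - r′)_s, and w_0 = (x+1)^p ≡ x^p + 1.
-- For s ≥ p both sides vanish, since p divides s! and (s - r′)_s.

module Submission where

open import Defs

module FModP where

  open import Data.Bool using (true; false; T)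
  open import Data.Bool.Properties using (T-≡; ∧-zeroʳ)
  open import Data.Empty using (⊥-elim)
  open import Data.Nat as ℕ using (ℕ; zero; suc; _≤_; _<_; z≤n; s≤s; _∸_; _!; _≤ᵇ_; _≡ᵇ_)
  import Data.Nat.Properties as ℕP
  import Data.Nat.Divisibility as ℕD
  open import Data.Nat.Primality using (Prime; euclidsLemma; prime⇒nonTrivial)
  open import Data.Nat.Tactic.RingSolver using () renaming (solve-∀ to ℕ-solve-∀)
  open import Data.Integer as ℤ using (ℤ; +_; -_; _+_; _-_; _*_; _^_; 0ℤ; 1ℤ; ∣_∣)
  import Data.Integer.Properties as ℤP
  open import Data.Integer.Divisibility.Signed as ℤD using (divides; ∣ᵤ⇒∣; ∣⇒∣ᵤ) renaming (_∣_ to _∣ₛ_)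
  open import Data.Integer.DivMod using (_%ℕ_; _/ℕ_; a≡a%ℕn+[a/ℕn]*n; n%ℕd<d)
  open import Data.Integer.Tactic.RingSolver using (solve-∀)
  open import Data.Sum using (_⊎_; inj₁; inj₂)
  open import Function.Bundles using (Equivalence)
  open import Relation.Binary.PropositionalEquality
  open import Relation.Nullary using (¬_; yes; no)
  open import Relation.Binary.Definitions using (tri<; tri≈; tri>)

  sum-cong : ∀ {f g : ℕ → ℤ} n → (∀ i → i < n → f i ≡ g i) → sumBelow f n ≡ sumBelow g n
  sum-cong zero h = refl
  sum-cong (suc n) h = cong₂ _+_ (sum-cong n (λ i i<n → h i (ℕP.m<n⇒m<1+n i<n))) (h n ℕP.≤-refl)

  sum-+ : ∀ (f g : ℕ → ℤ) n → sumBelow (λ i → f i + g i) n ≡ sumBelow f n + sumBelow g n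
  sum-+ f g zero = refl
  sum-+ f g (suc n) rewrite sum-+ f g n = interchange (sumBelow f n) (sumBelow g n) (f n) (g n)
    where
    interchange : ∀ a b c d → a + b + (c + d) ≡ a + c + (b + d)
    interchange = solve-∀

  sum-*ˡ : ∀ (c : ℤ) (f : ℕ → ℤ) n → sumBelow (λ i → c * f i) n ≡ c * sumBelow f n
  sum-*ˡ c f zero = sym (ℤP.*-zeroʳ c)
  sum-*ˡ c f (suc n) rewrite sum-*ˡ c f n = sym (ℤP.*-distribˡ-+ c (sumBelow f n) (f n))

  sum-neg : ∀ (f : ℕ → ℤ) n → sumBelow (λ i → - f i) n ≡ - sumBelow f n
  sum-neg f zero = refl
  sum-neg f (suc n) rewrite sum-neg f n = sym (ℤP.neg-distrib-+ (sumBelow f n) (f n))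

  sum-zero : ∀ {f : ℕ → ℤ} n → (∀ i → i < n → f i ≡ 0ℤ) → sumBelow f n ≡ 0ℤ
  sum-zero zero h = refl
  sum-zero (suc n) h rewrite sum-zero n (λ i i<n → h i (ℕP.m<n⇒m<1+n i<n)) | h n ℕP.≤-refl = refl

  sum-- : ∀ (f g : ℕ → ℤ) n → sumBelow (λ i → f i - g i) n ≡ sumBelow f n - sumBelow g n
  sum-- f g n = trans (sum-+ f (λ i → - g i) n) (cong (λ z → sumBelow f n + z) (sum-neg g n))

  sum-shift : ∀ (f : ℕ → ℤ) n → sumBelow f (suc n) ≡ f 0 + sumBelow (λ i → f (suc i)) n
  sum-shift f zero = ℤP.+-comm 0ℤ (f 0)
  sum-shift f (suc n) rewrite sum-shift f n = ℤP.+-assoc (f 0) (sumBelow (λ i → f (suc i)) n) (f (suc n))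

  sum-delta : ∀ {f : ℕ → ℤ} n t → t < n → (∀ i → i < n → i ≢ t → f i ≡ 0ℤ) → sumBelow f n ≡ f t
  sum-delta {f} (suc n) t t<n h with ℕP.m≤n⇒m<n∨m≡n (ℕP.≤-pred t<n)
  ... | inj₁ t<n′ rewrite sum-delta n t t<n′ (λ i i<n ne → h i (ℕP.m<n⇒m<1+n i<n) ne)
                        | h n ℕP.≤-refl (λ e → ℕP.<-irrefl (sym e) t<n′) = ℤP.+-identityʳ (f t)
  ... | inj₂ refl rewrite sum-zero {f} n (λ i i<n → h i (ℕP.m<n⇒m<1+n i<n) (λ e → ℕP.<-irrefl e i<n)) =
    ℤP.+-identityˡ (f n)

  -- Abel summation against the difference sequence Δb (Δb 0 = b 0,
  -- Δb (j+1) = b (j+1) - b j); used to telescope the signed binomial sums.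
  Δ : (ℕ → ℤ) → ℕ → ℤ
  Δ b zero = b 0
  Δ b (suc j) = b (suc j) - b j

  abel : ∀ (b W : ℕ → ℤ) L →
    sumBelow (λ j → Δ b j * W j) (suc L) ≡ sumBelow (λ j → b j * (W j - W (suc j))) (suc L) + b L * W (suc L)
  abel b W zero = split (b 0) (W 0) (W 1)
    where
    split : ∀ b w w′ → 0ℤ + b * w ≡ 0ℤ + b * (w - w′) + b * w′
    split = solve-∀
  abel b W (suc L) rewrite abel b W L =
    step (sumBelow (λ j → b j * (W j - W (suc j))) (suc L)) (b L) (b (suc L)) (W (suc L)) (W (suc (suc L)))
    where
    step : ∀ S b b′ w w′ → S + b * w + (b′ - b) * w ≡ S + b′ * (w - w′) + b′ * w′
    step = solve-∀

  module Congruence (P : ℤ) where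
    -- a record rather than a synonym, so that a and b are inferable from a proof
    infix 4 _≋_
    record _≋_ (a b : ℤ) : Set where
      constructor mk
      field get : P ∣ₛ (a - b)
    open _≋_ public

    private
      via : ∀ {a b x} → x ≡ a - b → P ∣ₛ x → a ≋ b
      via e d = mk (subst (P ∣ₛ_) e d)

    ≋-reflexive : ∀ {a b} → a ≡ b → a ≋ b
    ≋-reflexive {a} refl = via (sym (ℤP.+-inverseʳ a)) (divides 0ℤ (sym (ℤP.*-zeroˡ P)))

    ≋-refl : ∀ {a} → a ≋ a
    ≋-refl = ≋-reflexive refl

    ≋-sym : ∀ {a b} → a ≋ b → b ≋ a
    ≋-sym {a} {b} (mk d) = via (flip a b) (ℤD.∣m⇒∣-m d)
      where
      flip : ∀ a b → - (a - b) ≡ b - a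
      flip = solve-∀

    ≋-trans : ∀ {a b c} → a ≋ b → b ≋ c → a ≋ c
    ≋-trans {a} {b} {c} (mk d) (mk d′) = via (chain a b c) (ℤD.∣m∣n⇒∣m+n d d′)
      where
      chain : ∀ a b c → (a - b) + (b - c) ≡ a - c
      chain = solve-∀

    ≋-+ : ∀ {a b c d} → a ≋ b → c ≋ d → a + c ≋ b + d
    ≋-+ {a} {b} {c} {d} (mk x) (mk y) = via (regroup a b c d) (ℤD.∣m∣n⇒∣m+n x y)
      where
      regroup : ∀ a b c d → (a - b) + (c - d) ≡ a + c - (b + d)
      regroup = solve-∀

    ≋-neg : ∀ {a b} → a ≋ b → - a ≋ - b
    ≋-neg {a} {b} (mk d) = via (negate a b) (ℤD.∣m⇒∣-m d)
      where
      negate : ∀ a b → - (a - b) ≡ - a - - b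
      negate = solve-∀

    ≋-- : ∀ {a b c d} → a ≋ b → c ≋ d → a - c ≋ b - d
    ≋-- x y = ≋-+ x (≋-neg y)

    ≋-*ˡ : ∀ c {a b} → a ≋ b → c * a ≋ c * b
    ≋-*ˡ c {a} {b} (mk d) = via (distrib c a b) (ℤD.∣n⇒∣m*n c d)
      where
      distrib : ∀ c a b → c * (a - b) ≡ c * a - c * b
      distrib = solve-∀

    ≋-*ʳ : ∀ c {a b} → a ≋ b → a * c ≋ b * c
    ≋-*ʳ c {a} {b} h rewrite ℤP.*-comm a c | ℤP.*-comm b c = ≋-*ˡ c h

    ≋-* : ∀ {a b c d} → a ≋ b → c ≋ d → a * c ≋ b * d
    ≋-* {b = b} {c = c} x y = ≋-trans (≋-*ʳ c x) (≋-*ˡ b y)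

    ∣⇒≋0 : ∀ {a} → P ∣ₛ a → a ≋ 0ℤ
    ∣⇒≋0 {a} = via (sym (ℤP.+-identityʳ a))

    ≋0⇒∣ : ∀ {a} → a ≋ 0ℤ → P ∣ₛ a
    ≋0⇒∣ {a} (mk d) = subst (P ∣ₛ_) (ℤP.+-identityʳ a) d

    +-multiple : ∀ x y → x + P * y ≋ x
    +-multiple x y = via (cancel x P y) (ℤD.∣m⇒∣m*n y ℤD.∣-refl)
      where
      cancel : ∀ x P y → P * y ≡ x + P * y - x
      cancel = solve-∀

    sum-≋ : ∀ {f g : ℕ → ℤ} n → (∀ i → i < n → f i ≋ g i) → sumBelow f n ≋ sumBelow g n
    sum-≋ zero h = ≋-refl
    sum-≋ (suc n) h = ≋-+ (sum-≋ n (λ i i<n → h i (ℕP.m<n⇒m<1+n i<n))) (h n ℕP.≤-refl)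

    sum-≋-delta : ∀ {f : ℕ → ℤ} n t → t < n → (∀ i → i < n → i ≢ t → f i ≋ 0ℤ) → sumBelow f n ≋ f t
    sum-≋-delta {f} (suc n) t t<n off with ℕP.m≤n⇒m<n∨m≡n (ℕP.≤-pred t<n)
    ... | inj₁ t<n′ = ≋-trans (≋-+ (sum-≋-delta n t t<n′ (λ i i<n → off i (ℕP.m<n⇒m<1+n i<n)))
                                    (off n ℕP.≤-refl (λ n≡t → ℕP.<-irrefl (sym n≡t) t<n′)))
                              (≋-reflexive (ℤP.+-identityʳ (f t)))
    ... | inj₂ refl = ≋-trans (≋-+ (≋-trans (sum-≋ n (λ i i<n → off i (ℕP.m<n⇒m<1+n i<n) (λ i≡n → ℕP.<-irrefl i≡n i<n)))
                                            (≋-reflexive (sum-zero n (λ _ _ → refl))))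
                                   ≋-refl)
                              (≋-reflexive (ℤP.+-identityˡ (f n)))

    ^-≋1 : ∀ x e m → x ^ e ≋ 1ℤ → x ^ (m ℕ.* e) ≋ 1ℤ
    ^-≋1 x e zero _ = ≋-refl
    ^-≋1 x e (suc m) xᵉ≋1 = ≋-trans (≋-reflexive (ℤP.^-distribˡ-+-* x e (m ℕ.* e))) (≋-* xᵉ≋1 (^-≋1 x e m xᵉ≋1))

    ^-≋0 : ∀ x e → 0 < e → P ∣ₛ x → x ^ e ≋ 0ℤ
    ^-≋0 x (suc e) _ P∣x = ∣⇒≋0 (ℤD.∣m⇒∣m*n (x ^ e) P∣x)

    *P-≋0ʳ : ∀ f g → (∀ t → g t ≋ 0ℤ) → ∀ k → (f *P g) k ≋ 0ℤ
    *P-≋0ʳ f g g≋0 k =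
      ≋-trans (sum-≋ (suc k) (λ i _ → ≋-trans (≋-*ˡ (f i) (g≋0 (k ∸ i))) (≋-reflexive (ℤP.*-zeroʳ (f i)))))
              (≋-reflexive (sum-zero (suc k) (λ _ _ → refl)))

    *P-≋0ˡ : ∀ f g → (∀ t → f t ≋ 0ℤ) → ∀ k → (f *P g) k ≋ 0ℤ
    *P-≋0ˡ f g f≋0 k =
      ≋-trans (sum-≋ (suc k) (λ i _ → ≋-trans (≋-*ʳ (g (k ∸ i)) (f≋0 i)) (≋-reflexive (ℤP.*-zeroˡ (g (k ∸ i))))))
              (≋-reflexive (sum-zero (suc k) (λ _ _ → refl)))

    infixr 2 _≋⟨_⟩_ _≡⟨_⟩≋_
    infix 3 _∎≋
    _≋⟨_⟩_ : ∀ a {b c} → a ≋ b → b ≋ c → a ≋ c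
    a ≋⟨ x ⟩ y = ≋-trans x y
    _≡⟨_⟩≋_ : ∀ a {b c} → a ≡ b → b ≋ c → a ≋ c
    a ≡⟨ refl ⟩≋ y = y
    _∎≋ : ∀ a → a ≋ a
    a ∎≋ = ≋-refl

  -- Binomial coefficients, defined by Pascal's rule so that the triangle
  -- recurrence holds by computation.
  binom : ℕ → ℕ → ℕ
  binom zero zero = 1
  binom zero (suc k) = 0
  binom (suc n) zero = 1
  binom (suc n) (suc k) = binom n k ℕ.+ binom n (suc k)

  binom-0 : ∀ n → binom n 0 ≡ 1
  binom-0 zero = refl
  binom-0 (suc n) = refl

  binom-1 : ∀ n → binom n 1 ≡ n
  binom-1 zero = refl
  binom-1 (suc n) rewrite binom-0 n | binom-1 n = refl

  binom-above : ∀ n k → n < k → binom n k ≡ 0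
  binom-above zero (suc k) _ = refl
  binom-above (suc n) (suc k) (s≤s n<k)
    rewrite binom-above n k n<k | binom-above n (suc k) (ℕP.m<n⇒m<1+n n<k) = refl

  binom-diag : ∀ n → binom n n ≡ 1
  binom-diag zero = refl
  binom-diag (suc n) rewrite binom-diag n | binom-above n (suc n) ℕP.≤-refl = refl

  binom-absorb : ∀ n k → suc k ℕ.* binom (suc n) (suc k) ≡ suc n ℕ.* binom n k
  binom-absorb zero zero = refl
  binom-absorb zero (suc k) rewrite binom-above 0 (suc k) (s≤s z≤n) = ℕP.*-zeroʳ (suc (suc k))
  binom-absorb (suc n) zero rewrite binom-0 n | binom-1 n | ℕP.+-identityʳ n | ℕP.*-identityʳ n = refl
  binom-absorb (suc n) (suc k) = begin
      suc (suc k) ℕ.* (b₁ ℕ.+ b₂)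
    ≡⟨ regroup k b₁ b₂ ⟩
      suc k ℕ.* b₁ ℕ.+ (b₁ ℕ.+ suc (suc k) ℕ.* b₂)
    ≡⟨ cong₂ (λ u v → u ℕ.+ (b₁ ℕ.+ v)) (binom-absorb n k) (binom-absorb n (suc k)) ⟩
      suc n ℕ.* binom n k ℕ.+ (binom n k ℕ.+ binom n (suc k) ℕ.+ suc n ℕ.* binom n (suc k))
    ≡⟨ collect n (binom n k) (binom n (suc k)) ⟩
      suc (suc n) ℕ.* (binom n k ℕ.+ binom n (suc k)) ∎
    where
    open ≡-Reasoning
    b₁ = binom (suc n) (suc k)
    b₂ = binom (suc n) (suc (suc k))
    regroup : ∀ a b c → suc (suc a) ℕ.* (b ℕ.+ c) ≡ suc a ℕ.* b ℕ.+ (b ℕ.+ suc (suc a) ℕ.* c)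
    regroup = ℕ-solve-∀
    collect : ∀ n x y → suc n ℕ.* x ℕ.+ (x ℕ.+ y ℕ.+ suc n ℕ.* y) ≡ suc (suc n) ℕ.* (x ℕ.+ y)
    collect = ℕ-solve-∀

  binom-ratio : ∀ q a → (1ℤ + + a) * + binom q (suc a) + + a * + binom q a ≡ + q * + binom q a
  binom-ratio q a = begin
      + suc a * + binom q (suc a) + + a * + binom q a
    ≡⟨ cong₂ _+_ (sym (ℤP.pos-* (suc a) (binom q (suc a)))) (sym (ℤP.pos-* a (binom q a))) ⟩
      + (suc a ℕ.* binom q (suc a) ℕ.+ a ℕ.* binom q a)
    ≡⟨ cong +_ (ratio q a) ⟩
      + (q ℕ.* binom q a)
    ≡⟨ ℤP.pos-* q (binom q a) ⟩
      + q * + binom q a ∎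
    where
    open ≡-Reasoning
    ratio : ∀ q a → suc a ℕ.* binom q (suc a) ℕ.+ a ℕ.* binom q a ≡ q ℕ.* binom q a
    ratio zero zero = refl
    ratio zero (suc a) rewrite ℕP.*-zeroʳ a = refl
    ratio (suc q) zero rewrite binom-absorb q zero | binom-0 q = ℕP.+-identityʳ _
    ratio (suc q) (suc a) rewrite binom-absorb q (suc a) | binom-absorb q a =
      trans (sym (ℕP.*-distribˡ-+ (suc q) (binom q (suc a)) (binom q a)))
            (cong (suc q ℕ.*_) (ℕP.+-comm (binom q (suc a)) (binom q a)))

  pascal-sum : ∀ n (f : ℕ → ℤ) L →
    sumBelow (λ i → + binom (suc n) i * f i) (suc L)
      ≡ sumBelow (λ i → + binom n i * f i) (suc L) + sumBelow (λ i → + binom n i * f (suc i)) L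
  pascal-sum n f L = begin
      sumBelow (λ i → + binom (suc n) i * f i) (suc L)
    ≡⟨ sum-shift _ L ⟩
      1ℤ * f 0 + sumBelow (λ i → + (binom n i ℕ.+ binom n (suc i)) * f (suc i)) L
    ≡⟨ cong (λ z → 1ℤ * f 0 + z) (trans (sum-cong L (λ i _ → split i)) (sum-+ _ _ L)) ⟩
      1ℤ * f 0 + (lower + upper)
    ≡⟨ regroup (1ℤ * f 0) lower upper ⟩
      (1ℤ * f 0 + upper) + lower
    ≡⟨ cong (λ z → (+ z * f 0 + upper) + lower) (sym (binom-0 n)) ⟩
      (+ binom n 0 * f 0 + upper) + lower
    ≡⟨ cong (_+ lower) (sym (sum-shift (λ i → + binom n i * f i) L)) ⟩
      sumBelow (λ i → + binom n i * f i) (suc L) + lower ∎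
    where
    open ≡-Reasoning
    lower = sumBelow (λ i → + binom n i * f (suc i)) L
    upper = sumBelow (λ i → + binom n (suc i) * f (suc i)) L
    split : ∀ i → + (binom n i ℕ.+ binom n (suc i)) * f (suc i)
                 ≡ + binom n i * f (suc i) + + binom n (suc i) * f (suc i)
    split i = trans (cong (_* f (suc i)) (ℤP.pos-+ (binom n i) (binom n (suc i))))
                    (ℤP.*-distribʳ-+ (f (suc i)) (+ binom n i) (+ binom n (suc i)))
    regroup : ∀ a b c → a + (b + c) ≡ (a + c) + b
    regroup = solve-∀

  suc∸ : ∀ {i k} → i ≤ k → suc k ∸ i ≡ suc (k ∸ i)
  suc∸ = ℕP.+-∸-assoc 1

  *P-congʳ : ∀ f {g g′ : Poly} → (∀ k → g k ≡ g′ k) → ∀ k → (f *P g) k ≡ (f *P g′) k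
  *P-congʳ f h k = sum-cong (suc k) (λ i _ → cong (f i *_) (h (k ∸ i)))

  *P-degree0 : ∀ f g k → (∀ t → g (suc t) ≡ 0ℤ) → (f *P g) k ≡ f k * g 0
  *P-degree0 f g k g₊≡0 = trans (sum-delta (suc k) k ℕP.≤-refl off-diagonal) (cong (λ z → f k * g z) (ℕP.n∸n≡0 k))
    where
    off-diagonal : ∀ i → i < suc k → i ≢ k → f i * g (k ∸ i) ≡ 0ℤ
    off-diagonal i (s≤s i≤k) i≢k with ℕP.m≤n⇒m<n∨m≡n i≤k
    ... | inj₂ i≡k = ⊥-elim (i≢k i≡k)
    ... | inj₁ i<k rewrite suc∸ i<k | g₊≡0 (k ∸ suc i) = ℤP.*-zeroʳ (f i)

  *C : ∀ a g k → (g *P C a) k ≡ g k * a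
  *C a g k = *P-degree0 g (C a) k (λ _ → refl)

  C* : ∀ a g k → (C a *P g) k ≡ a * g k
  C* a g k = begin
      (C a *P g) k
    ≡⟨ sum-shift _ k ⟩
      a * g k + sumBelow (λ i → 0ℤ * g (k ∸ suc i)) k
    ≡⟨ cong (λ z → a * g k + z) (sum-zero k (λ i _ → ℤP.*-zeroˡ (g (k ∸ suc i)))) ⟩
      a * g k + 0ℤ
    ≡⟨ ℤP.+-identityʳ _ ⟩
      a * g k ∎
    where open ≡-Reasoning

  *P-distrib-P : ∀ f g h k → (f *P (g -P h)) k ≡ (f *P g) k - (f *P h) k
  *P-distrib-P f g h k = begin
      sumBelow (λ i → f i * (g (k ∸ i) - h (k ∸ i))) (suc k)
    ≡⟨ sum-cong (suc k) (λ i _ → distrib (f i) (g (k ∸ i)) (h (k ∸ i))) ⟩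
      sumBelow (λ i → f i * g (k ∸ i) + - (f i * h (k ∸ i))) (suc k)
    ≡⟨ sum-+ _ _ (suc k) ⟩
      (f *P g) k + sumBelow (λ i → - (f i * h (k ∸ i))) (suc k)
    ≡⟨ cong (λ z → (f *P g) k + z) (sum-neg _ (suc k)) ⟩
      (f *P g) k - (f *P h) k ∎
    where
    open ≡-Reasoning
    distrib : ∀ a b c → a * (b - c) ≡ a * b + - (a * c)
    distrib = solve-∀

  X+1*-zero : ∀ g → (X+1 *P g) 0 ≡ g 0
  X+1*-zero g = trans (ℤP.+-identityˡ (1ℤ * g 0)) (ℤP.*-identityˡ (g 0))

  X+1*-suc : ∀ g k → (X+1 *P g) (suc k) ≡ g (suc k) + g k
  X+1*-suc g k = begin
      (X+1 *P g) (suc k)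
    ≡⟨ sum-shift _ (suc k) ⟩
      1ℤ * g (suc k) + sumBelow (λ i → X+1 (suc i) * g (k ∸ i)) (suc k)
    ≡⟨ cong (λ z → 1ℤ * g (suc k) + z) (sum-shift _ k) ⟩
      1ℤ * g (suc k) + (1ℤ * g k + sumBelow (λ i → 0ℤ * g (k ∸ suc i)) k)
    ≡⟨ cong (λ z → 1ℤ * g (suc k) + (1ℤ * g k + z)) (sum-zero k (λ i _ → ℤP.*-zeroˡ (g (k ∸ suc i)))) ⟩
      1ℤ * g (suc k) + (1ℤ * g k + 0ℤ)
    ≡⟨ cong₂ _+_ (ℤP.*-identityˡ (g (suc k))) (trans (ℤP.+-identityʳ (1ℤ * g k)) (ℤP.*-identityˡ (g k))) ⟩
      g (suc k) + g k ∎
    where open ≡-Reasoning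

  X+1^-coeff : ∀ e k → (X+1 ^P e) k ≡ + binom e k
  X+1^-coeff zero zero = refl
  X+1^-coeff zero (suc k) = refl
  X+1^-coeff (suc e) zero rewrite X+1*-zero (X+1 ^P e) | X+1^-coeff e 0 | binom-0 e = refl
  X+1^-coeff (suc e) (suc k) rewrite X+1*-suc (X+1 ^P e) k | X+1^-coeff e (suc k) | X+1^-coeff e k =
    ℤP.+-comm (+ binom e (suc k)) (+ binom e k)

  X+1^*-coeff : ∀ e g k → ((X+1 ^P e) *P g) k ≡ sumBelow (λ i → + binom e i * g (k ∸ i)) (suc k)
  X+1^*-coeff e g k = sum-cong (suc k) (λ i _ → cong (_* g (k ∸ i)) (X+1^-coeff e i))

  X+1^*-step : ∀ e g k → ((X+1 ^P suc e) *P g) k ≡ (X+1 *P ((X+1 ^P e) *P g)) k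
  X+1^*-step e g zero = begin
      ((X+1 ^P suc e) *P g) 0
    ≡⟨ X+1^*-coeff (suc e) g 0 ⟩
      0ℤ + 1ℤ * g 0
    ≡⟨ cong (λ z → 0ℤ + + z * g 0) (sym (binom-0 e)) ⟩
      0ℤ + + binom e 0 * g 0
    ≡⟨ sym (trans (X+1*-zero ((X+1 ^P e) *P g)) (X+1^*-coeff e g 0)) ⟩
      (X+1 *P ((X+1 ^P e) *P g)) 0 ∎
    where open ≡-Reasoning
  X+1^*-step e g (suc k) = begin
      ((X+1 ^P suc e) *P g) (suc k)
    ≡⟨ X+1^*-coeff (suc e) g (suc k) ⟩
      sumBelow (λ i → + binom (suc e) i * g (suc k ∸ i)) (suc (suc k))
    ≡⟨ pascal-sum e (λ i → g (suc k ∸ i)) (suc k) ⟩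
      sumBelow (λ i → + binom e i * g (suc k ∸ i)) (suc (suc k)) + sumBelow (λ i → + binom e i * g (k ∸ i)) (suc k)
    ≡⟨ sym (cong₂ _+_ (X+1^*-coeff e g (suc k)) (X+1^*-coeff e g k)) ⟩
      ((X+1 ^P e) *P g) (suc k) + ((X+1 ^P e) *P g) k
    ≡⟨ sym (X+1*-suc ((X+1 ^P e) *P g) k) ⟩
      (X+1 *P ((X+1 ^P e) *P g)) (suc k) ∎
    where open ≡-Reasoning

  shift : ℕ → Poly → Poly
  shift zero g k = g k
  shift (suc c) g zero = 0ℤ
  shift (suc c) g (suc k) = shift c g k

  *X^ : ∀ g c k → (g *P X^ c) k ≡ shift c g k
  *X^ g zero k = trans (*P-degree0 g (X^ 0) k (λ _ → refl)) (ℤP.*-identityʳ (g k))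
  *X^ g (suc c) zero = trans (ℤP.+-identityˡ _) (ℤP.*-zeroʳ (g 0))
  *X^ g (suc c) (suc k) = begin
      sumBelow (λ i → g i * X^ (suc c) (suc k ∸ i)) (suc k) + g (suc k) * X^ (suc c) (suc k ∸ suc k)
    ≡⟨ cong₂ _+_ (sum-cong (suc k) (λ i i<k+1 → cong (λ z → g i * X^ (suc c) z) (suc∸ (ℕP.≤-pred i<k+1))))
                 (trans (cong (λ z → g (suc k) * X^ (suc c) z) (ℕP.n∸n≡0 k)) (ℤP.*-zeroʳ (g (suc k)))) ⟩
      (g *P X^ c) k + 0ℤ
    ≡⟨ ℤP.+-identityʳ _ ⟩
      (g *P X^ c) k
    ≡⟨ *X^ g c k ⟩
      shift c g k ∎
    where open ≡-Reasoning

  shift-below : ∀ c g k → k < c → shift c g k ≡ 0ℤ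
  shift-below (suc c) g zero _ = refl
  shift-below (suc c) g (suc k) (s≤s k<c) = shift-below c g k k<c

  shift-above : ∀ c g a → shift c g (c ℕ.+ a) ≡ g a
  shift-above zero g a = refl
  shift-above (suc c) g a = shift-above c g a

  shift-cong : ∀ c {g g′ : Poly} → (∀ t → g t ≡ g′ t) → ∀ k → shift c g k ≡ shift c g′ k
  shift-cong zero h k = h k
  shift-cong (suc c) h zero = refl
  shift-cong (suc c) h (suc k) = shift-cong c h k

  shift-scale : ∀ c (a : ℤ) g k → shift c (λ t → a * g t) k ≡ a * shift c g k
  shift-scale zero a g k = refl
  shift-scale (suc c) a g zero = sym (ℤP.*-zeroʳ a)
  shift-scale (suc c) a g (suc k) = shift-scale c a g k

  ≡true : ∀ {b} → T b → b ≡ true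
  ≡true = Equivalence.to T-≡

  ≡false : ∀ {b} → ¬ T b → b ≡ false
  ≡false {true} ¬t = ⊥-elim (¬t _)
  ≡false {false} _ = refl

  ≤ᵇ-true : ∀ {m n} → m ≤ n → (m ≤ᵇ n) ≡ true
  ≤ᵇ-true m≤n = ≡true (ℕP.≤⇒≤ᵇ m≤n)

  ≤ᵇ-false : ∀ {m n} → ¬ m ≤ n → (m ≤ᵇ n) ≡ false
  ≤ᵇ-false {m} {n} m≰n = ≡false (λ t → m≰n (ℕP.≤ᵇ⇒≤ m n t))

  ≡ᵇ-true : ∀ {m n} → m ≡ n → (m ≡ᵇ n) ≡ true
  ≡ᵇ-true {m} {n} m≡n = ≡true (ℕP.≡⇒≡ᵇ m n m≡n)

  ≡ᵇ-false : ∀ {m n} → m ≢ n → (m ≡ᵇ n) ≡ false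
  ≡ᵇ-false {m} {n} m≢n = ≡false (λ t → m≢n (ℕP.≡ᵇ⇒≡ m n t))

  stirling-diag : ∀ r → rStirling r r r ≡ 1
  stirling-diag zero = refl
  stirling-diag (suc r) rewrite ≤ᵇ-true (ℕP.≤-refl {suc r}) | ≡ᵇ-true (refl {x = suc r}) = refl

  module _ (r : ℕ) where

    stirling-below : ∀ N K → K < r → rStirling r N K ≡ 0
    stirling-below zero K K<r rewrite ≡ᵇ-false {r} {0} (λ r≡0 → ℕP.<⇒≢ (ℕP.≤-trans (s≤s z≤n) K<r) (sym r≡0)) = refl
    stirling-below (suc N) zero K<r = refl
    stirling-below (suc N) (suc K) K<r with suc N ≤ᵇ r
    ... | true rewrite ≡ᵇ-false {suc K} {r} (ℕP.<⇒≢ K<r) | ∧-zeroʳ (suc N ≡ᵇ r) = refl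
    ... | false rewrite stirling-below N (suc K) K<r | stirling-below N K (ℕP.<-trans (ℕP.n<1+n K) K<r)
                      | ℕP.*-zeroʳ K = refl

    stirling-above : ∀ N K → N < K → rStirling r N K ≡ 0
    stirling-above zero (suc K) _ rewrite ∧-zeroʳ (r ≡ᵇ 0) = refl
    stirling-above (suc N) (suc K) (s≤s N<K) with suc N ≤ᵇ r | suc N ≡ᵇ r in N+1≟r
    ... | true | true rewrite ≡ᵇ-false {suc K} {r} (λ K+1≡r → ℕP.<⇒≢ (s≤s N<K)
            (trans (ℕP.≡ᵇ⇒≡ _ _ (subst T (sym N+1≟r) _)) (sym K+1≡r))) = refl
    ... | true | false = refl
    ... | false | _ rewrite stirling-above N (suc K) (ℕP.m<n⇒m<1+n N<K) | stirling-above N K N<K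
                          | ℕP.*-zeroʳ K = refl

    stirling-rec : ∀ N K → r ≤ N →
      rStirling r (suc N) (suc K) ≡ suc K ℕ.* rStirling r N (suc K) ℕ.+ rStirling r N K
    stirling-rec N K r≤N rewrite ≤ᵇ-false {suc N} {r} (λ N<r → ℕP.<-irrefl refl (ℕP.≤-trans N<r r≤N)) = refl

  -- The coefficient {n+r, k+r}_r (k+s)! of F_n, with no truncation at k ≤ n
  -- (for k > n the Stirling number vanishes anyway).
  Fcoeff : ℕ → ℕ → ℕ → ℕ → ℕ
  Fcoeff r s n k = rStirling r (n ℕ.+ r) (k ℕ.+ r) ℕ.* (k ℕ.+ s) !

  F-coeff : ∀ r s n k → F n r s k ≡ + Fcoeff r s n k
  F-coeff r s n k with k ≤ᵇ n in k≤ᵇn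
  ... | true = refl
  ... | false rewrite stirling-above r (n ℕ.+ r) (k ℕ.+ r)
                        (ℕP.+-monoˡ-< r (ℕP.≰⇒> (λ k≤n → subst T k≤ᵇn (ℕP.≤⇒≤ᵇ k≤n)))) = refl

  F-zero : ∀ r s k → F 0 r s k ≡ C (+ (s !)) k
  F-zero r s zero rewrite F-coeff r s 0 0 | stirling-diag r = cong +_ (ℕP.+-identityʳ (s !))
  F-zero r s (suc k) rewrite F-coeff r s 0 (suc k) | stirling-above r r (suc k ℕ.+ r) (s≤s (ℕP.m≤n+m r k)) = refl

  -- The first-order operator  θ_{r,c} = x(1+x) d/dx + r + c·x,  coefficientwise:
  --   (θ g)_0 = r g_0,   (θ g)_{k+1} = (k+1+r) g_{k+1} + (k+c) g_k.
  θ : ℕ → ℕ → Poly → Poly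
  θ r c g zero = + r * g 0
  θ r c g (suc k) = (1ℤ + + k + + r) * g (suc k) + (+ k + + c) * g k

  θ-cong : ∀ r c {g g′ : Poly} → (∀ k → g k ≡ g′ k) → ∀ k → θ r c g k ≡ θ r c g′ k
  θ-cong r c h zero = cong (+ r *_) (h 0)
  θ-cong r c h (suc k) = cong₂ (λ a b → (1ℤ + + k + + r) * a + (+ k + + c) * b) (h (suc k)) (h k)

  θ-sum : ∀ r c (f : ℕ → Poly) L k →
    θ r c (λ t → sumBelow (λ j → f j t) L) k ≡ sumBelow (λ j → θ r c (f j) k) L
  θ-sum r c f L zero = sym (sum-*ˡ (+ r) (λ j → f j 0) L)
  θ-sum r c f L (suc k) = begin
      a * sumBelow (λ j → f j (suc k)) L + b * sumBelow (λ j → f j k) L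
    ≡⟨ sym (cong₂ _+_ (sum-*ˡ a (λ j → f j (suc k)) L) (sum-*ˡ b (λ j → f j k) L)) ⟩
      sumBelow (λ j → a * f j (suc k)) L + sumBelow (λ j → b * f j k) L
    ≡⟨ sym (sum-+ _ _ L) ⟩
      sumBelow (λ j → θ r c (f j) (suc k)) L ∎
    where
    open ≡-Reasoning
    a = 1ℤ + + k + + r
    b = + k + + c

  θ-scale : ∀ r c (x : ℤ) g k → θ r c (λ t → x * g t) k ≡ x * θ r c g k
  θ-scale r c x g zero = swap (+ r) x (g 0)
    where
    swap : ∀ a x y → a * (x * y) ≡ x * (a * y)
    swap = solve-∀
  θ-scale r c x g (suc k) = factor (1ℤ + + k + + r) (+ k + + c) x (g (suc k)) (g k)
    where
    factor : ∀ a b x y z → a * (x * y) + b * (x * z) ≡ x * (a * y + b * z)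
    factor = solve-∀

  F-rec : ∀ r s n k → F (suc n) r s k ≡ θ r (s ℕ.+ 1) (F n r s) k
  F-rec r s n zero rewrite F-coeff r s (suc n) 0 | F-coeff r s n 0 = trans (cong +_ (rec₀ r)) (ℤP.pos-* r (Fcoeff r s n 0))
    where
    rec₀ : ∀ r → Fcoeff r s (suc n) 0 ≡ r ℕ.* Fcoeff r s n 0
    rec₀ zero = refl
    rec₀ (suc r) rewrite stirling-rec (suc r) (n ℕ.+ suc r) r (ℕP.m≤n+m (suc r) n)
                       | stirling-below (suc r) (n ℕ.+ suc r) r ℕP.≤-refl =
      reassoc (suc r) (rStirling (suc r) (n ℕ.+ suc r) (suc r)) (s !)
      where
      reassoc : ∀ a b c → (a ℕ.* b ℕ.+ 0) ℕ.* c ≡ a ℕ.* (b ℕ.* c)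
      reassoc = ℕ-solve-∀
  F-rec r s n (suc k)
    rewrite F-coeff r s (suc n) (suc k) | F-coeff r s n (suc k) | F-coeff r s n k
          | stirling-rec r (n ℕ.+ r) (k ℕ.+ r) (ℕP.m≤n+m r n)
          | trans (sym (ℕP.+-assoc k s 1)) (ℕP.+-comm (k ℕ.+ s) 1) =
    trans (cong +_ (expand (suc (k ℕ.+ r)) (rStirling r (n ℕ.+ r) (suc (k ℕ.+ r))) (rStirling r (n ℕ.+ r) (k ℕ.+ r))
                           (suc (k ℕ.+ s)) ((k ℕ.+ s) !)))
    (trans (ℤP.pos-+ (suc (k ℕ.+ r) ℕ.* Fcoeff r s n (suc k)) (suc (k ℕ.+ s) ℕ.* Fcoeff r s n k))
           (cong₂ _+_ (ℤP.pos-* (suc (k ℕ.+ r)) (Fcoeff r s n (suc k))) (ℤP.pos-* (suc (k ℕ.+ s)) (Fcoeff r s n k))))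
    where
    expand : ∀ a A₁ A₀ b X → (a ℕ.* A₁ ℕ.+ A₀) ℕ.* (b ℕ.* X) ≡ a ℕ.* (A₁ ℕ.* (b ℕ.* X)) ℕ.+ b ℕ.* (A₀ ℕ.* X)
    expand = ℕ-solve-∀

  θ-X+1 : ∀ r c g k → (X+1 *P θ r (suc c) g) k ≡ θ r c (X+1 *P g) k
  θ-X+1 r c g zero rewrite X+1*-zero (θ r (suc c) g) | X+1*-zero g = refl
  θ-X+1 r c g (suc zero) rewrite X+1*-suc (θ r (suc c) g) 0 | X+1*-suc g 0 | X+1*-zero g =
    identity (+ r) (+ c) (g 1) (g 0)
    where
    identity : ∀ r c g₁ g₀ → (1ℤ + 0ℤ + r) * g₁ + (0ℤ + (1ℤ + c)) * g₀ + r * g₀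
                           ≡ (1ℤ + 0ℤ + r) * (g₁ + g₀) + (0ℤ + c) * g₀
    identity = solve-∀
  θ-X+1 r c g (suc (suc k)) rewrite X+1*-suc (θ r (suc c) g) (suc k) | X+1*-suc g (suc k) | X+1*-suc g k =
    identity (+ r) (+ c) (+ k) (g (suc (suc k))) (g (suc k)) (g k)
    where
    identity : ∀ r c k g₂ g₁ g₀ →
      (1ℤ + (1ℤ + k) + r) * g₂ + ((1ℤ + k) + (1ℤ + c)) * g₁ + ((1ℤ + k + r) * g₁ + (k + (1ℤ + c)) * g₀)
        ≡ (1ℤ + (1ℤ + k) + r) * (g₂ + g₁) + ((1ℤ + k) + c) * (g₁ + g₀)
    identity = solve-∀

  θ-X+1^ : ∀ r e c g k → ((X+1 ^P e) *P θ r (e ℕ.+ c) g) k ≡ θ r c ((X+1 ^P e) *P g) k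
  θ-X+1^ r zero c g k =
    trans (C* 1ℤ (θ r c g) k) (trans (ℤP.*-identityˡ _) (θ-cong r c (λ t → sym (trans (C* 1ℤ g t) (ℤP.*-identityˡ (g t)))) k))
  θ-X+1^ r (suc e) c g k = begin
      ((X+1 ^P suc e) *P θ r (suc e ℕ.+ c) g) k
    ≡⟨ X+1^*-step e (θ r (suc e ℕ.+ c) g) k ⟩
      (X+1 *P ((X+1 ^P e) *P θ r (suc (e ℕ.+ c)) g)) k
    ≡⟨ *P-congʳ X+1 (λ t → trans (cong (λ z → ((X+1 ^P e) *P θ r z g) t) (sym (ℕP.+-suc e c)))
                                  (θ-X+1^ r e (suc c) g t)) k ⟩
      (X+1 *P θ r (suc c) ((X+1 ^P e) *P g)) k
    ≡⟨ θ-X+1 r c ((X+1 ^P e) *P g) k ⟩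
      θ r c (X+1 *P ((X+1 ^P e) *P g)) k
    ≡⟨ θ-cong r c (λ t → sym (X+1^*-step e g t)) k ⟩
      θ r c ((X+1 ^P suc e) *P g) k ∎
    where open ≡-Reasoning

  H : ℕ → ℕ → ℕ → Poly
  H r s n = (X+1 ^P (s ℕ.+ 1)) *P F n r s

  H-rec : ∀ r s n k → H r s (suc n) k ≡ θ r 0 (H r s n) k
  H-rec r s n k = begin
      H r s (suc n) k
    ≡⟨ *P-congʳ (X+1 ^P (s ℕ.+ 1)) (λ t → trans (F-rec r s n t) (cong (λ z → θ r z (F n r s) t) (sym (ℕP.+-identityʳ (s ℕ.+ 1))))) k ⟩
      ((X+1 ^P (s ℕ.+ 1)) *P θ r (s ℕ.+ 1 ℕ.+ 0) (F n r s)) k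
    ≡⟨ θ-X+1^ r (s ℕ.+ 1) 0 (F n r s) k ⟩
      θ r 0 (H r s n) k ∎
    where open ≡-Reasoning

  H-zero : ∀ r s k → H r s 0 k ≡ + binom (s ℕ.+ 1) k * + (s !)
  H-zero r s k = trans (*P-congʳ (X+1 ^P (s ℕ.+ 1)) (F-zero r s) k)
                       (trans (*C (+ (s !)) (X+1 ^P (s ℕ.+ 1)) k) (cong (_* + (s !)) (X+1^-coeff (s ℕ.+ 1) k)))

  -- The polynomials  w T j = x^j (x+1)^{T-j}.
  binomPoly : ℕ → Poly
  binomPoly q t = + binom q t

  w : ℕ → ℕ → Poly
  w T j = shift j (binomPoly (T ∸ j))

  shift-pascal : ∀ q j k → shift j (binomPoly (suc q)) k ≡ shift j (binomPoly q) k + shift (suc j) (binomPoly q) k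
  shift-pascal q zero zero rewrite binom-0 q = refl
  shift-pascal q zero (suc k) = ℤP.+-comm (+ binom q k) (+ binom q (suc k))
  shift-pascal q (suc j) zero = refl
  shift-pascal q (suc j) (suc k) = shift-pascal q j k

  w-split : ∀ T j k → j ≤ T → w (suc T) j k ≡ w T j k + w (suc T) (suc j) k
  w-split T j k j≤T = trans (cong (λ q → shift j (binomPoly q) k) (suc∸ j≤T)) (shift-pascal (T ∸ j) j k)

  -- Each w T j (j ≤ T) is an eigenvector of θ_{r,0} up to T·x·w T j:
  --   θ_{r,0} (w T j) = (j + r) w T j + T · x · w T j.
  -- Modulo a prime T = p this is an exact eigenvalue equation.
  w-eigen : ∀ T r j k → j ≤ T → θ r 0 (w T j) k ≡ (+ j + + r) * w T j k + + T * shift 1 (w T j) k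
  w-eigen T r zero zero _ rewrite ℤP.*-zeroʳ (+ T) = sym (ℤP.+-identityʳ _)
  w-eigen T r (suc j) zero _ rewrite ℤP.*-zeroʳ (+ T) | ℤP.*-zeroʳ (+ r) | ℤP.*-zeroʳ (+ suc j + + r) = refl
  w-eigen T r j (suc k) j≤T with j ℕ.≤? k
  ... | yes j≤k = subst (λ z → θ r 0 (w T j) (suc z) ≡ (+ j + + r) * w T j (suc z) + + T * w T j z)
                        (ℕP.m+[n∸m]≡n j≤k) (above (k ∸ j))
    where
    -- at degrees j + a + 1 the eigenvalue equation is the binomial ratio identity
    above : ∀ a → θ r 0 (w T j) (suc (j ℕ.+ a)) ≡ (+ j + + r) * w T j (suc (j ℕ.+ a)) + + T * w T j (j ℕ.+ a)
    above a = begin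
        (1ℤ + + (j ℕ.+ a) + + r) * W₁ + (+ (j ℕ.+ a) + + 0) * W₀
      ≡⟨ cong₂ (λ x y → (1ℤ + + (j ℕ.+ a) + + r) * x + (+ (j ℕ.+ a) + + 0) * y) W₁≡b₁ W₀≡b₀ ⟩
        (1ℤ + (+ j + + a) + + r) * b₁ + ((+ j + + a) + 0ℤ) * b₀
      ≡⟨ regroup (+ j) (+ a) (+ r) b₁ b₀ ⟩
        ((+ j + + r) * b₁ + + j * b₀) + ((1ℤ + + a) * b₁ + + a * b₀)
      ≡⟨ cong (λ z → ((+ j + + r) * b₁ + + j * b₀) + z) (binom-ratio (T ∸ j) a) ⟩
        ((+ j + + r) * b₁ + + j * b₀) + + (T ∸ j) * b₀
      ≡⟨ collect (+ j) (+ r) (+ (T ∸ j)) b₁ b₀ ⟩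
        (+ j + + r) * b₁ + + (T ∸ j ℕ.+ j) * b₀
      ≡⟨ cong (λ z → (+ j + + r) * b₁ + + z * b₀) (ℕP.m∸n+n≡m j≤T) ⟩
        (+ j + + r) * b₁ + + T * b₀
      ≡⟨ sym (cong₂ (λ x y → (+ j + + r) * x + + T * y) W₁≡b₁ W₀≡b₀) ⟩
        (+ j + + r) * W₁ + + T * W₀ ∎
      where
      open ≡-Reasoning
      b₁ = + binom (T ∸ j) (suc a)
      b₀ = + binom (T ∸ j) a
      W₁ = w T j (suc (j ℕ.+ a))
      W₀ = w T j (j ℕ.+ a)
      W₁≡b₁ : W₁ ≡ b₁
      W₁≡b₁ = trans (cong (shift j (binomPoly (T ∸ j))) (sym (ℕP.+-suc j a))) (shift-above j (binomPoly (T ∸ j)) (suc a))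
      W₀≡b₀ : W₀ ≡ b₀
      W₀≡b₀ = shift-above j (binomPoly (T ∸ j)) a
      regroup : ∀ J A R b₁ b₀ → (1ℤ + (J + A) + R) * b₁ + ((J + A) + 0ℤ) * b₀
                              ≡ ((J + R) * b₁ + J * b₀) + ((1ℤ + A) * b₁ + A * b₀)
      regroup = solve-∀
      collect : ∀ J R Q b₁ b₀ → ((J + R) * b₁ + J * b₀) + Q * b₀ ≡ (J + R) * b₁ + (Q + J) * b₀
      collect = solve-∀
  ... | no j≰k with ℕP.m≤n⇒m<n∨m≡n (ℕP.≰⇒> j≰k)
  ...   | inj₁ k+1<j rewrite shift-below j (binomPoly (T ∸ j)) (suc k) k+1<j
                           | shift-below j (binomPoly (T ∸ j)) k (ℕP.≰⇒> j≰k)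
                           | ℤP.*-zeroʳ (1ℤ + + k + + r) | ℤP.*-zeroʳ (+ k + + 0)
                           | ℤP.*-zeroʳ (+ j + + r) | ℤP.*-zeroʳ (+ T) = refl
  ...   | inj₂ refl rewrite shift-below (suc k) (binomPoly (T ∸ suc k)) k ℕP.≤-refl
                          | ℤP.*-zeroʳ (+ k + + 0) | ℤP.*-zeroʳ (+ T) = refl

  sign : ℕ → ℤ
  sign zero = 1ℤ
  sign (suc j) = - sign j

  sbinom : ℕ → ℕ → ℤ
  sbinom N j = sign j * + binom N j

  sbinom-above : ∀ N j → N < j → sbinom N j ≡ 0ℤ
  sbinom-above N j N<j rewrite binom-above N j N<j = ℤP.*-zeroʳ (sign j)

  sbinom-pascal : ∀ N j → sbinom (suc N) j ≡ Δ (sbinom N) j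
  sbinom-pascal N zero rewrite binom-0 N = refl
  sbinom-pascal N (suc j) rewrite ℤP.pos-+ (binom N j) (binom N (suc j)) =
    alternate (sign j) (+ binom N j) (+ binom N (suc j))
    where
    alternate : ∀ σ b b′ → - σ * (b + b′) ≡ - σ * b′ - σ * b
    alternate = solve-∀

  -- The expansion  (x+1)^e = Σ_{j ≤ N} (-1)^j C(N,j) x^j (x+1)^{N+e-j},
  -- i.e.  (x+1)^e = ((x+1) - x)^N (x+1)^e,  proved by Abel summation in N.
  decompose : ∀ N e k L → N < L → sumBelow (λ j → sbinom N j * w (N ℕ.+ e) j k) L ≡ + binom e k
  decompose zero e k (suc L) _ = begin
      sumBelow (λ j → sbinom 0 j * w e j k) (suc L)
    ≡⟨ sum-shift _ L ⟩
      1ℤ * w e 0 k + sumBelow (λ j → sbinom 0 (suc j) * w e (suc j) k) L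
    ≡⟨ cong₂ _+_ (ℤP.*-identityˡ (w e 0 k))
                 (sum-zero L (λ j _ → trans (cong (_* w e (suc j) k) (sbinom-above 0 (suc j) (s≤s z≤n)))
                                            (ℤP.*-zeroˡ (w e (suc j) k)))) ⟩
      + binom e k + 0ℤ
    ≡⟨ ℤP.+-identityʳ _ ⟩
      + binom e k ∎
    where open ≡-Reasoning
  decompose (suc N) e k (suc L) (s≤s N<L) = begin
      sumBelow (λ j → sbinom (suc N) j * W j) (suc L)
    ≡⟨ sum-cong (suc L) (λ j _ → cong (_* W j) (sbinom-pascal N j)) ⟩
      sumBelow (λ j → Δ (sbinom N) j * W j) (suc L)
    ≡⟨ abel (sbinom N) W L ⟩
      sumBelow (λ j → sbinom N j * (W j - W (suc j))) (suc L) + sbinom N L * W (suc L)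
    ≡⟨ cong₂ _+_ (sum-cong (suc L) (λ j _ → telescoped j))
                 (trans (cong (_* W (suc L)) (sbinom-above N L N<L)) (ℤP.*-zeroˡ (W (suc L)))) ⟩
      sumBelow (λ j → sbinom N j * w (N ℕ.+ e) j k) (suc L) + 0ℤ
    ≡⟨ trans (ℤP.+-identityʳ _) (decompose N e k (suc L) (ℕP.m<n⇒m<1+n N<L)) ⟩
      + binom e k ∎
    where
    open ≡-Reasoning
    W : ℕ → ℤ
    W j = w (suc (N ℕ.+ e)) j k
    telescoped : ∀ j → sbinom N j * (W j - W (suc j)) ≡ sbinom N j * w (N ℕ.+ e) j k
    telescoped j with j ℕ.≤? N
    ... | yes j≤N = cong (sbinom N j *_)
            (trans (cong (_- W (suc j)) (w-split (N ℕ.+ e) j k (ℕP.≤-trans j≤N (ℕP.m≤m+n N e))))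
                   (cancel (w (N ℕ.+ e) j k) (W (suc j))))
      where
      cancel : ∀ a b → a + b - b ≡ a
      cancel = solve-∀
    ... | no j≰N rewrite sbinom-above N j (ℕP.≰⇒> j≰N) =
      trans (ℤP.*-zeroˡ (W j - W (suc j))) (sym (ℤP.*-zeroˡ (w (N ℕ.+ e) j k)))

  binomial-theorem : ∀ x n → (x + 1ℤ) ^ n ≡ sumBelow (λ i → + binom n i * x ^ i) (suc n)
  binomial-theorem x zero = refl
  binomial-theorem x (suc n) = sym (begin
      sumBelow (λ i → + binom (suc n) i * x ^ i) (suc (suc n))
    ≡⟨ pascal-sum n (x ^_) (suc n) ⟩
      (S + + binom n (suc n) * x ^ suc n) + sumBelow (λ i → + binom n i * (x * x ^ i)) (suc n)
    ≡⟨ cong₂ _+_ (cong (λ b → S + + b * x ^ suc n) (binom-above n (suc n) ℕP.≤-refl))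
                 (trans (sum-cong (suc n) (λ i _ → swap (+ binom n i) x (x ^ i))) (sum-*ˡ x _ (suc n))) ⟩
      (S + 0ℤ * x ^ suc n) + x * S
    ≡⟨ factor S x (x ^ suc n) ⟩
      (x + 1ℤ) * S
    ≡⟨ cong ((x + 1ℤ) *_) (sym (binomial-theorem x n)) ⟩
      (x + 1ℤ) ^ suc n ∎)
    where
    open ≡-Reasoning
    S = sumBelow (λ i → + binom n i * x ^ i) (suc n)
    swap : ∀ b x y → b * (x * y) ≡ x * (b * y)
    swap = solve-∀
    factor : ∀ S x y → (S + 0ℤ * y) + x * S ≡ (x + 1ℤ) * S
    factor = solve-∀

  module Fermat (n : ℕ) (isPrime : Prime (suc n)) where
    open Congruence (+ suc n)

    euclid : ∀ x y → + suc n ∣ₛ x * y → (+ suc n ∣ₛ x) ⊎ (+ suc n ∣ₛ y)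
    euclid x y p∣xy with euclidsLemma ∣ x ∣ ∣ y ∣ isPrime (subst (suc n ℕD.∣_) (ℤP.abs-* x y) (∣⇒∣ᵤ p∣xy))
    ... | inj₁ p∣x = inj₁ (∣ᵤ⇒∣ p∣x)
    ... | inj₂ p∣y = inj₂ (∣ᵤ⇒∣ p∣y)

    cancel : ∀ c x → ¬ (suc n ℕD.∣ c) → + c * x ≋ 0ℤ → x ≋ 0ℤ
    cancel c x p∤c cx≋0 with euclid (+ c) x (≋0⇒∣ cx≋0)
    ... | inj₁ p∣c = ⊥-elim (p∤c (∣⇒∣ᵤ p∣c))
    ... | inj₂ p∣x = ∣⇒≋0 p∣x

    -- p divides C(p,i) for 0 < i < p, by absorption.
    binom-prime : ∀ i → 0 < i → i < suc n → + suc n ∣ₛ + binom (suc n) i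
    binom-prime (suc k) _ (s≤s k<n)
      with euclidsLemma (suc k) (binom (suc n) (suc k)) isPrime
             (subst (suc n ℕD.∣_) (sym (binom-absorb n k)) (ℕD.m∣m*n (binom n k)))
    ... | inj₁ p∣k+1 = ⊥-elim (ℕP.<-irrefl refl (ℕP.≤-trans (s≤s (s≤s k<n)) (s≤s (ℕD.∣⇒≤ p∣k+1))))
    ... | inj₂ p∣binom = ∣ᵤ⇒∣ p∣binom

    frobenius : ∀ x → (x + 1ℤ) ^ suc n ≋ x ^ suc n + 1ℤ
    frobenius x =
      (x + 1ℤ) ^ suc n
        ≡⟨ binomial-theorem x (suc n) ⟩≋
      sumBelow (λ i → + binom (suc n) i * x ^ i) (suc (suc n))
        ≡⟨ sum-shift _ (suc n) ⟩≋
      1ℤ * 1ℤ + (sumBelow (λ i → + binom (suc n) (suc i) * x ^ suc i) n + + binom (suc n) (suc n) * x ^ suc n)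
        ≋⟨ ≋-+ (≋-refl {1ℤ * 1ℤ}) (≋-+ (sum-≋ n (λ i i<n → middle-vanishes i i<n)) ≋-refl) ⟩
      1ℤ * 1ℤ + (sumBelow (λ i → 0ℤ) n + + binom (suc n) (suc n) * x ^ suc n)
        ≡⟨ cong₂ (λ a b → 1ℤ * 1ℤ + (a + + b * x ^ suc n)) (sum-zero n (λ _ _ → refl)) (binom-diag (suc n)) ⟩≋
      1ℤ * 1ℤ + (0ℤ + 1ℤ * x ^ suc n)
        ≡⟨ simplify (x ^ suc n) ⟩≋
      x ^ suc n + 1ℤ ∎≋
      where
      middle-vanishes : ∀ i → i < n → + binom (suc n) (suc i) * x ^ suc i ≋ 0ℤ
      middle-vanishes i i<n = ∣⇒≋0 (ℤD.∣m⇒∣m*n (x ^ suc i) (binom-prime (suc i) (s≤s z≤n) (s≤s i<n)))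
      simplify : ∀ y → 1ℤ * 1ℤ + (0ℤ + 1ℤ * y) ≡ y + 1ℤ
      simplify = solve-∀

    fermat-pow : ∀ a → (+ a) ^ suc n ≋ + a
    fermat-pow zero = ≋-refl
    fermat-pow (suc a) =
      (+ suc a) ^ suc n
        ≡⟨ cong (_^ suc n) (ℤP.+-comm 1ℤ (+ a)) ⟩≋
      (+ a + 1ℤ) ^ suc n
        ≋⟨ frobenius (+ a) ⟩
      (+ a) ^ suc n + 1ℤ
        ≋⟨ ≋-+ (fermat-pow a) ≋-refl ⟩
      + a + 1ℤ
        ≡⟨ ℤP.+-comm (+ a) 1ℤ ⟩≋
      + suc a ∎≋

    fermat : ∀ a → ¬ (suc n ℕD.∣ a) → (+ a) ^ n ≋ 1ℤ
    fermat a p∤a = ≋-sym (mk (≋0⇒∣ (cancel a (1ℤ - (+ a) ^ n) p∤a a[1-aⁿ]≋0)))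
      where
      a[1-aⁿ]≋0 : + a * (1ℤ - (+ a) ^ n) ≋ 0ℤ
      a[1-aⁿ]≋0 =
        + a * (1ℤ - (+ a) ^ n)
          ≡⟨ distrib (+ a) ((+ a) ^ n) ⟩≋
        + a - (+ a) ^ suc n
          ≋⟨ ≋-- (≋-refl {+ a}) (fermat-pow a) ⟩
        + a - + a
          ≡⟨ ℤP.+-inverseʳ (+ a) ⟩≋
        0ℤ ∎≋
        where
        distrib : ∀ A X → A * (1ℤ - X) ≡ A - A * X
        distrib = solve-∀

  falling-below : ∀ t s → t < s → falling (+ t) s ≡ 0ℤ
  falling-below t (suc s) t<s with ℕP.m≤n⇒m<n∨m≡n (ℕP.≤-pred t<s)
  ... | inj₁ t<s′ rewrite falling-below t s t<s′ = refl
  ... | inj₂ refl rewrite ℤP.+-inverseʳ (+ t) = ℤP.*-zeroʳ (falling (+ t) t)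

  falling-step : ∀ y s → falling (1ℤ + y) s * (1ℤ + y - + s) ≡ (1ℤ + y) * falling y s
  falling-step y zero = unit y
    where
    unit : ∀ y → 1ℤ * (1ℤ + y - 0ℤ) ≡ (1ℤ + y) * 1ℤ
    unit = solve-∀
  falling-step y (suc s) = begin
      falling (1ℤ + y) s * (1ℤ + y - + s) * (1ℤ + y - (1ℤ + + s))
    ≡⟨ cong (_* (1ℤ + y - (1ℤ + + s))) (falling-step y s) ⟩
      (1ℤ + y) * falling y s * (1ℤ + y - (1ℤ + + s))
    ≡⟨ reassoc (1ℤ + y) (falling y s) y (+ s) ⟩
      (1ℤ + y) * (falling y s * (y - + s)) ∎
    where
    open ≡-Reasoning
    reassoc : ∀ a f y s → a * f * (1ℤ + y - (1ℤ + s)) ≡ a * (f * (y - s))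
    reassoc = solve-∀

  falling-diag : ∀ s → falling (+ s) s ≡ + (s !)
  falling-diag zero = refl
  falling-diag (suc s) = begin
      falling (1ℤ + + s) s * (1ℤ + + s - + s)
    ≡⟨ falling-step (+ s) s ⟩
      (1ℤ + + s) * falling (+ s) s
    ≡⟨ cong ((1ℤ + + s) *_) (falling-diag s) ⟩
      + suc s * + (s !)
    ≡⟨ sym (ℤP.pos-* (suc s) (s !)) ⟩
      + (suc s !) ∎
    where open ≡-Reasoning

  falling-factor : ∀ a s t → t < s → (a - + t) ∣ₛ falling a s
  falling-factor a (suc s) t t<s with ℕP.m≤n⇒m<n∨m≡n (ℕP.≤-pred t<s)
  ... | inj₁ t<s′ = ℤD.∣m⇒∣m*n (a - + s) (falling-factor a s t t<s′)
  ... | inj₂ refl = ℤD.∣n⇒∣m*n (falling a t) ℤD.∣-refl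

  falling-multiple : ∀ d .{{_ : ℕ.NonZero d}} a s → d ≤ s → + d ∣ₛ falling a s
  falling-multiple d a s d≤s =
    ℤD.∣-trans (divides (a /ℕ d) a-[a%d]≡q*d) (falling-factor a s (a %ℕ d) (ℕP.<-≤-trans (n%ℕd<d a d) d≤s))
    where
    a-[a%d]≡q*d : a - + (a %ℕ d) ≡ (a /ℕ d) * + d
    a-[a%d]≡q*d = trans (cong (_- + (a %ℕ d)) (a≡a%ℕn+[a/ℕn]*n a d)) (cancel (+ (a %ℕ d)) (a /ℕ d) (+ d))
      where
      cancel : ∀ t q d → t + q * d - t ≡ q * d
      cancel = solve-∀

  falling-cong : ∀ (P : ℤ) s {a b} → Congruence._≋_ P a b → Congruence._≋_ P (falling a s) (falling b s)
  falling-cong P zero _ = Congruence.≋-refl P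
  falling-cong P (suc s) a≋b = Congruence.≋-* P (falling-cong P s a≋b) (Congruence.≋-- P a≋b (Congruence.≋-refl P))

  -- If N + s + 1 = p is prime, then
  --   s! (-1)^c C(N,c) ≡ (s+c)_s  (mod p)   for c ≤ N:
  -- both sides satisfy the same first-order recurrence in c modulo p,
  -- because s + c + 1 ≡ -(N - c), and c + 1 is invertible modulo p.
  -- The coefficients  α_{s,N}(j) = s! (-1)^j C(N,j)  of the expansion of
  -- s! (x+1)^{s+1} in the polynomials w (N+s+1) j.
  α : ℕ → ℕ → ℕ → ℤ
  α s N j = + (s !) * sbinom N j

  module ExpansionConstants (n : ℕ) (isPrime : Prime (suc n)) (s N : ℕ) (N+s+1≡p : N ℕ.+ (s ℕ.+ 1) ≡ suc n) where
    open Fermat n isPrime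
    open Congruence (+ suc n)

    β : ℕ → ℤ
    β c = falling (+ (s ℕ.+ c)) s

    α-step : ∀ c → (1ℤ + + c) * α s N (suc c) ≡ - ((+ N - + c) * α s N c)
    α-step c = begin
        (1ℤ + + c) * (+ (s !) * (- σ * b₁))
      ≡⟨ pull (1ℤ + + c) (+ (s !)) σ b₁ ⟩
        - (+ (s !) * σ) * ((1ℤ + + c) * b₁)
      ≡⟨ cong (λ z → - (+ (s !) * σ) * z) (isolate _ _ _ (binom-ratio N c)) ⟩
        - (+ (s !) * σ) * (+ N * b₀ - + c * b₀)
      ≡⟨ push (+ (s !)) σ (+ N) (+ c) b₀ ⟩
        - ((+ N - + c) * (+ (s !) * (σ * b₀))) ∎
      where
      open ≡-Reasoning
      σ = sign c
      b₁ = + binom N (suc c)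
      b₀ = + binom N c
      pull : ∀ a F σ b → a * (F * (- σ * b)) ≡ - (F * σ) * (a * b)
      pull = solve-∀
      isolate : ∀ x y z → x + y ≡ z → x ≡ z - y
      isolate x y z x+y≡z = trans (add-sub x y) (cong (_- y) x+y≡z)
        where
        add-sub : ∀ x y → x ≡ x + y - y
        add-sub = solve-∀
      push : ∀ F σ N c b → - (F * σ) * (N * b - c * b) ≡ - ((N - c) * (F * (σ * b)))
      push = solve-∀

    β-step : ∀ c → (1ℤ + + c) * β (suc c) ≡ (1ℤ + + (s ℕ.+ c)) * β c
    β-step c = begin
        (1ℤ + + c) * falling (+ (s ℕ.+ suc c)) s
      ≡⟨ cong (λ z → (1ℤ + + c) * falling (+ z) s) (ℕP.+-suc s c) ⟩
        (1ℤ + + c) * falling (1ℤ + + (s ℕ.+ c)) s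
      ≡⟨ cong (_* falling (1ℤ + + (s ℕ.+ c)) s) (difference (+ s) (+ c)) ⟩
        (1ℤ + + (s ℕ.+ c) - + s) * falling (1ℤ + + (s ℕ.+ c)) s
      ≡⟨ ℤP.*-comm (1ℤ + + (s ℕ.+ c) - + s) (falling (1ℤ + + (s ℕ.+ c)) s) ⟩
        falling (1ℤ + + (s ℕ.+ c)) s * (1ℤ + + (s ℕ.+ c) - + s)
      ≡⟨ falling-step (+ (s ℕ.+ c)) s ⟩
        (1ℤ + + (s ℕ.+ c)) * β c ∎
      where
      open ≡-Reasoning
      difference : ∀ s c → 1ℤ + c ≡ 1ℤ + (s + c) - s
      difference = solve-∀

    s+c+1≋c-N : ∀ c → 1ℤ + + (s ℕ.+ c) ≋ - (+ N - + c)
    s+c+1≋c-N c = mk (divides 1ℤ (trans (rearrange (+ s) (+ c) (+ N))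
                                        (trans (cong +_ (trans (ℕP.+-comm (s ℕ.+ 1) N) N+s+1≡p))
                                               (sym (ℤP.*-identityˡ (+ suc n))))))
      where
      rearrange : ∀ s c N → 1ℤ + (s + c) - - (N - c) ≡ (s + 1ℤ) + N
      rearrange = solve-∀

    α≋β : ∀ c → c ≤ N → α s N c ≋ β c
    α≋β zero _ rewrite binom-0 N | ℕP.+-identityʳ s | falling-diag s = ≋-reflexive (ℤP.*-identityʳ (+ (s !)))
    α≋β (suc c) c<N = mk (≋0⇒∣ (cancel (suc c) (α s N (suc c) - β (suc c)) p∤c+1 difference-vanishes))
      where
      p∤c+1 : ¬ (suc n ℕD.∣ suc c)
      p∤c+1 p∣c+1 = ℕP.<-irrefl refl (ℕP.≤-<-trans (ℕP.≤-trans (ℕD.∣⇒≤ p∣c+1) c<N)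
                      (subst (N <_) N+s+1≡p (ℕP.m<m+n N (subst (0 <_) (ℕP.+-comm 1 s) (s≤s z≤n)))))
      difference-vanishes : (1ℤ + + c) * (α s N (suc c) - β (suc c)) ≋ 0ℤ
      difference-vanishes =
        (1ℤ + + c) * (α s N (suc c) - β (suc c))
          ≡⟨ ℤP.*-distribˡ-+ (1ℤ + + c) (α s N (suc c)) (- β (suc c)) ⟩≋
        (1ℤ + + c) * α s N (suc c) + (1ℤ + + c) * - β (suc c)
          ≡⟨ cong₂ _+_ (α-step c) (trans (sym (ℤP.neg-distribʳ-* (1ℤ + + c) (β (suc c)))) (cong -_ (β-step c))) ⟩≋
        - ((+ N - + c) * α s N c) + - ((1ℤ + + (s ℕ.+ c)) * β c)
          ≋⟨ ≋-+ (≋-neg (≋-*ˡ (+ N - + c) (α≋β c (ℕP.<⇒≤ c<N)))) (≋-neg (≋-*ʳ (β c) (s+c+1≋c-N c))) ⟩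
        - ((+ N - + c) * β c) + - (- (+ N - + c) * β c)
          ≡⟨ cancels (+ N - + c) (β c) ⟩≋
        0ℤ ∎≋
        where
        cancels : ∀ x b → - (x * b) + - (- x * b) ≡ 0ℤ
        cancels = solve-∀

  -- With p = N + s + 1 (any p here), and
  --   D_n = Σ_{j<p} α_j (j+r)^n w p j,
  -- we have H_0 = D_0 exactly, and θ_{r,0} D_n ≡ D_{n+1} (mod p) by the
  -- eigenvalue equation, so H_n ≡ D_n (mod p) for all n.
  module Expansion (p r s N : ℕ) (N+s+1≡p : N ℕ.+ (s ℕ.+ 1) ≡ p) where
    open Congruence (+ p)

    N<p : N < p
    N<p = subst (N <_) N+s+1≡p (ℕP.m<m+n N (subst (0 <_) (ℕP.+-comm 1 s) (s≤s z≤n)))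

    D : ℕ → Poly
    D n k = sumBelow (λ j → α s N j * ((+ j + + r) ^ n * w p j k)) p

    D-zero : ∀ k → D 0 k ≡ H r s 0 k
    D-zero k = begin
        sumBelow (λ j → + (s !) * sbinom N j * (1ℤ * w p j k)) p
      ≡⟨ sum-cong p (λ j _ → reassoc (+ (s !)) (sbinom N j) (w p j k)) ⟩
        sumBelow (λ j → + (s !) * (sbinom N j * w p j k)) p
      ≡⟨ sum-*ˡ (+ (s !)) _ p ⟩
        + (s !) * sumBelow (λ j → sbinom N j * w p j k) p
      ≡⟨ cong (λ T → + (s !) * sumBelow (λ j → sbinom N j * w T j k) p) (sym N+s+1≡p) ⟩
        + (s !) * sumBelow (λ j → sbinom N j * w (N ℕ.+ (s ℕ.+ 1)) j k) p
      ≡⟨ cong (+ (s !) *_) (decompose N (s ℕ.+ 1) k p N<p) ⟩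
        + (s !) * + binom (s ℕ.+ 1) k
      ≡⟨ trans (ℤP.*-comm (+ (s !)) _) (sym (H-zero r s k)) ⟩
        H r s 0 k ∎
      where
      open ≡-Reasoning
      reassoc : ∀ f b x → f * b * (1ℤ * x) ≡ f * (b * x)
      reassoc = solve-∀

    θ-≋ : ∀ c {g g′ : Poly} → (∀ k → g k ≋ g′ k) → ∀ k → θ r c g k ≋ θ r c g′ k
    θ-≋ c g≋g′ zero = ≋-*ˡ (+ r) (g≋g′ 0)
    θ-≋ c g≋g′ (suc k) = ≋-+ (≋-*ˡ (1ℤ + + k + + r) (g≋g′ (suc k))) (≋-*ˡ (+ k + + c) (g≋g′ k))

    D-step : ∀ n k → θ r 0 (D n) k ≋ D (suc n) k
    D-step n k =
      θ r 0 (D n) k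
        ≡⟨ θ-sum r 0 (λ j t → α s N j * ((+ j + + r) ^ n * w p j t)) p k ⟩≋
      sumBelow (λ j → θ r 0 (λ t → α s N j * ((+ j + + r) ^ n * w p j t)) k) p
        ≡⟨ sum-cong p (λ j _ → trans (θ-scale r 0 (α s N j) _ k) (cong (α s N j *_) (θ-scale r 0 ((+ j + + r) ^ n) (w p j) k))) ⟩≋
      sumBelow (λ j → α s N j * ((+ j + + r) ^ n * θ r 0 (w p j) k)) p
        ≋⟨ sum-≋ p (λ j j<p → eigen-term j (ℕP.<⇒≤ j<p)) ⟩
      D (suc n) k ∎≋
      where
      eigen-term : ∀ j → j ≤ p → α s N j * ((+ j + + r) ^ n * θ r 0 (w p j) k) ≋ α s N j * ((+ j + + r) ^ suc n * w p j k)
      eigen-term j j≤p rewrite w-eigen p r j k j≤p =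
        ≋-trans (≋-reflexive (expand (α s N j) ((+ j + + r) ^ n) (+ j + + r) (w p j k) (+ p) (shift 1 (w p j) k)))
                (+-multiple _ _)
        where
        expand : ∀ a L l W P Z → a * (L * (l * W + P * Z)) ≡ a * (l * L * W) + P * (a * L * Z)
        expand = solve-∀

    H≋D : ∀ n k → H r s n k ≋ D n k
    H≋D zero k = ≋-reflexive (sym (D-zero k))
    H≋D (suc n) k =
      H r s (suc n) k
        ≡⟨ H-rec r s n k ⟩≋
      θ r 0 (H r s n) k
        ≋⟨ θ-≋ 0 (H≋D n) k ⟩
      θ r 0 (D n) k
        ≋⟨ D-step n k ⟩
      D (suc n) k ∎≋

  small-multiple : ∀ d x → d ℕD.∣ x → x < d ℕ.+ d → x ≡ 0 ⊎ x ≡ d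
  small-multiple d x (ℕD.divides zero x≡0) _ = inj₁ x≡0
  small-multiple d x (ℕD.divides (suc zero) x≡d) _ = inj₂ (trans x≡d (ℕP.+-identityʳ d))
  small-multiple d x (ℕD.divides (suc (suc q)) x≡[q+2]d) x<2d =
    ⊥-elim (ℕP.<-irrefl refl (ℕP.<-≤-trans x<2d (subst (d ℕ.+ d ≤_) (sym x≡[q+2]d) (ℕP.+-monoʳ-≤ d (ℕP.m≤m+n d (q ℕ.* d))))))

  module Corollary (n : ℕ) (isPrime : Prime (suc n)) (m r s r′ : ℕ) (1≤m : 1 ≤ m)
                   (r′<p : r′ < suc n) (p∣r-r′ : + suc n ∣ₛ (+ r - + r′)) where
    open Congruence (+ suc n)
    open Fermat n isPrime

    E : ℕ
    E = m ℕ.* n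

    LHS RHS₁ RHS₂ : Poly
    LHS = (X+1 ^P (s ℕ.+ 1)) *P (F E r s -P C (+ (s !)))
    RHS₁ = (C (- falling (+ s - + r′) s) *P (X+1 ^P r′)) *P X^ (suc n ∸ r′)
    RHS₂ = C (- (+ (s !))) *P (X^ (suc n) +P C (+ 1))

    p∣! : ∀ t → suc n ≤ t → suc n ℕD.∣ t !
    p∣! t p≤t = ℕD.∣-trans (ℕD.m∣m*n (n !)) (ℕD.m≤n⇒m!∣n! p≤t)

    -- If p ≤ s, both sides vanish modulo p: p divides s!, every (k+s)!, and (s - r′)_s.
    module LargeS (p≤s : suc n ≤ s) where
      LHS≋0 : ∀ k → LHS k ≋ 0ℤ
      LHS≋0 = *P-≋0ʳ (X+1 ^P (s ℕ.+ 1)) _ (λ t → ≋-- (F≋0 t) (C≋0 t))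
        where
        F≋0 : ∀ t → F E r s t ≋ 0ℤ
        F≋0 t rewrite F-coeff r s E t =
          ∣⇒≋0 (∣ᵤ⇒∣ (ℕD.∣-trans (p∣! (t ℕ.+ s) (ℕP.≤-trans p≤s (ℕP.m≤n+m s t))) (ℕD.n∣m*n (rStirling r (E ℕ.+ r) (t ℕ.+ r)))))
        C≋0 : ∀ t → C (+ (s !)) t ≋ 0ℤ
        C≋0 zero = ∣⇒≋0 (∣ᵤ⇒∣ (p∣! s p≤s))
        C≋0 (suc _) = ≋-refl

      RHS₁≋0 : ∀ k → RHS₁ k ≋ 0ℤ
      RHS₁≋0 = *P-≋0ˡ _ (X^ (suc n ∸ r′)) (λ t →
        ≋-trans (≋-reflexive (C* (- falling (+ s - + r′) s) (X+1 ^P r′) t))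
                (≋-trans (≋-*ʳ ((X+1 ^P r′) t) (≋-neg (∣⇒≋0 (falling-multiple (suc n) (+ s - + r′) s p≤s))))
                         (≋-reflexive (ℤP.*-zeroˡ ((X+1 ^P r′) t)))))

      RHS₂≋0 : ∀ k → RHS₂ k ≋ 0ℤ
      RHS₂≋0 k = ≋-trans (≋-reflexive (C* (- (+ (s !))) (X^ (suc n) +P C (+ 1)) k))
                   (≋-trans (≋-*ʳ ((X^ (suc n) +P C (+ 1)) k) (≋-neg (∣⇒≋0 {+ (s !)} (∣ᵤ⇒∣ (p∣! s p≤s)))))
                            (≋-reflexive (ℤP.*-zeroˡ ((X^ (suc n) +P C (+ 1)) k))))

    -- If s < p, expand H in the w's (N = p - s - 1) and apply Fermat.
    module SmallS (s<p : s < suc n) where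
      N : ℕ
      N = suc n ∸ (s ℕ.+ 1)

      N+s+1≡p : N ℕ.+ (s ℕ.+ 1) ≡ suc n
      N+s+1≡p = ℕP.m∸n+n≡m (subst (_≤ suc n) (ℕP.+-comm 1 s) s<p)

      open Expansion (suc n) r s N N+s+1≡p
      open ExpansionConstants n isPrime s N N+s+1≡p

      0<E : 0 < E
      0<E = ℕP.*-mono-≤ 1≤m (ℕP.≤-pred (ℕ.nonTrivial⇒n>1 (suc n) {{prime⇒nonTrivial isPrime}}))

      LHS-difference : ∀ k → LHS k ≡ H r s E k - H r s 0 k
      LHS-difference k = trans (*P-distrib-P (X+1 ^P (s ℕ.+ 1)) (F E r s) (C (+ (s !))) k)
        (cong (λ z → H r s E k - z) (trans (*C (+ (s !)) (X+1 ^P (s ℕ.+ 1)) k)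
          (trans (cong (_* + (s !)) (X+1^-coeff (s ℕ.+ 1) k)) (sym (H-zero r s k)))))

      -- The indices j < p with p ∣ j + r are those with j + r′ ∈ {0, p}.
      IsRoot : ℕ → Set
      IsRoot c = c ℕ.+ r′ ≡ 0 ⊎ c ℕ.+ r′ ≡ suc n

      root-divides : ∀ {c} → IsRoot c → + suc n ∣ₛ + (c ℕ.+ r)
      root-divides {c} root = subst (+ suc n ∣ₛ_) (shift-residue (+ c) (+ r) (+ r′)) (ℤD.∣m∣n⇒∣m+n (p∣c+r′ root) p∣r-r′)
        where
        p∣c+r′ : IsRoot c → + suc n ∣ₛ + (c ℕ.+ r′)
        p∣c+r′ (inj₁ c+r′≡0) rewrite c+r′≡0 = divides 0ℤ refl
        p∣c+r′ (inj₂ c+r′≡p) rewrite c+r′≡p = ℤD.∣-refl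
        shift-residue : ∀ c r r′ → (c + r′) + (r - r′) ≡ c + r
        shift-residue = solve-∀

      divides⇒root : ∀ j → j < suc n → + suc n ∣ₛ + (j ℕ.+ r) → IsRoot j
      divides⇒root j j<p p∣j+r = small-multiple (suc n) (j ℕ.+ r′) (∣⇒∣ᵤ p∣j+r′) (ℕP.+-mono-< j<p r′<p)
        where
        unshift : ∀ j r r′ → (j + r) - (r - r′) ≡ j + r′
        unshift = solve-∀
        p∣j+r′ : + suc n ∣ₛ + (j ℕ.+ r′)
        p∣j+r′ = subst (+ suc n ∣ₛ_) (unshift (+ j) (+ r) (+ r′)) (ℤD.∣m∣n⇒∣m-n p∣j+r p∣r-r′)

      roots-unique : ∀ {j c} → IsRoot j → IsRoot c → j < suc n → c < suc n → j ≡ c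
      roots-unique {j} {c} (inj₁ j+r′≡0) (inj₁ c+r′≡0) _ _ = ℕP.+-cancelʳ-≡ r′ j c (trans j+r′≡0 (sym c+r′≡0))
      roots-unique {j} {c} (inj₂ j+r′≡p) (inj₂ c+r′≡p) _ _ = ℕP.+-cancelʳ-≡ r′ j c (trans j+r′≡p (sym c+r′≡p))
      roots-unique {j} {c} (inj₁ j+r′≡0) (inj₂ c+r′≡p) _ c<p =
        ⊥-elim (ℕP.<-irrefl (sym (trans (sym c+r′≡p) (trans (cong (c ℕ.+_) (ℕP.m+n≡0⇒n≡0 j j+r′≡0)) (ℕP.+-identityʳ c)))) c<p)
      roots-unique {j} {c} (inj₂ j+r′≡p) (inj₁ c+r′≡0) j<p _ =
        ⊥-elim (ℕP.<-irrefl (sym (trans (sym j+r′≡p) (trans (cong (j ℕ.+_) (ℕP.m+n≡0⇒n≡0 c c+r′≡0)) (ℕP.+-identityʳ j)))) j<p)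

      -- Modulo p,  H_E - H_0 ≡ -α_c w_c  for the unique root c: all other
      -- terms of D_E - D_0 vanish by Fermat's little theorem.
      LHS≋root-term : ∀ c → c < suc n → IsRoot c → ∀ k → LHS k ≋ - (α s N c * w (suc n) c k)
      LHS≋root-term c c<p root k =
        LHS k
          ≡⟨ LHS-difference k ⟩≋
        H r s E k - H r s 0 k
          ≋⟨ ≋-- (H≋D E k) (≋-reflexive (sym (D-zero k))) ⟩
        D E k - D 0 k
          ≡⟨ sym (sum-- (term E) (term 0) (suc n)) ⟩≋
        sumBelow (λ j → term E j - term 0 j) (suc n)
          ≋⟨ sum-≋-delta (suc n) c c<p off-root ⟩
        term E c - term 0 c
          ≋⟨ ≋-- (≋-*ˡ (α s N c) (≋-*ʳ (w (suc n) c k) (^-≋0 (+ (c ℕ.+ r)) E 0<E (root-divides root)))) ≋-refl ⟩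
        α s N c * (0ℤ * w (suc n) c k) - α s N c * (1ℤ * w (suc n) c k)
          ≡⟨ simplify (α s N c) (w (suc n) c k) ⟩≋
        - (α s N c * w (suc n) c k) ∎≋
        where
        term : ℕ → ℕ → ℤ
        term e j = α s N j * ((+ j + + r) ^ e * w (suc n) j k)
        off-root : ∀ j → j < suc n → j ≢ c → term E j - term 0 j ≋ 0ℤ
        off-root j j<p j≢c =
          ≋-trans (≋-- (≋-*ˡ (α s N j) (≋-*ʳ (w (suc n) j k) (^-≋1 (+ (j ℕ.+ r)) n m (fermat (j ℕ.+ r) p∤j+r)))) ≋-refl)
                  (≋-reflexive (ℤP.+-inverseʳ (term 0 j)))
          where
          p∤j+r : ¬ (suc n ℕD.∣ j ℕ.+ r)
          p∤j+r p∣j+r = j≢c (roots-unique (divides⇒root j j<p (∣ᵤ⇒∣ p∣j+r)) root j<p c<p)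
        simplify : ∀ a x → a * (0ℤ * x) - a * (1ℤ * x) ≡ - (a * x)
        simplify = solve-∀

      -- r′ ≠ 0: the root is c = p - r′, and α_c ≡ (s - r′)_s.
      module NonzeroResidue (r′≢0 : r′ ≢ 0) where
        c : ℕ
        c = suc n ∸ r′

        c<p : c < suc n
        c<p = ℕP.∸-monoʳ-< {suc n} {r′} {0} (ℕP.n≢0⇒n>0 r′≢0) (ℕP.<⇒≤ r′<p)

        c+r′≡p : c ℕ.+ r′ ≡ suc n
        c+r′≡p = ℕP.m∸n+n≡m (ℕP.<⇒≤ r′<p)

        α≋falling : α s N c ≋ falling (+ s - + r′) s
        α≋falling with c ℕ.≤? N
        ... | yes c≤N = ≋-trans (α≋β c c≤N) (falling-cong (+ suc n) s s+c≋s-r′)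
          where
          difference : ∀ s c r′ → (s + c) - (s - r′) ≡ c + r′
          difference = solve-∀
          s+c≋s-r′ : + (s ℕ.+ c) ≋ + s - + r′
          s+c≋s-r′ = mk (divides 1ℤ (trans (difference (+ s) (+ c) (+ r′))
                                           (trans (cong +_ c+r′≡p) (sym (ℤP.*-identityˡ (+ suc n))))))
        ... | no c≰N = ≋-reflexive (trans α≡0 (sym falling≡0))
          where
          α≡0 : α s N c ≡ 0ℤ
          α≡0 = trans (cong (+ (s !) *_) (sbinom-above N c (ℕP.≰⇒> c≰N))) (ℤP.*-zeroʳ (+ (s !)))
          -- c > N = p - s - 1 forces r′ ≤ s, so 0 ≤ s - r′ < s
          r′≤s : r′ ≤ s
          r′≤s with r′ ℕ.≤? s
          ... | yes r′≤s = r′≤s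
          ... | no r′≰s = ⊥-elim (c≰N (ℕP.+-cancelʳ-≤ r′ c N (begin
              c ℕ.+ r′            ≡⟨ trans c+r′≡p (sym N+s+1≡p) ⟩
              N ℕ.+ (s ℕ.+ 1)     ≤⟨ ℕP.+-monoʳ-≤ N (subst (_≤ r′) (ℕP.+-comm 1 s) (ℕP.≰⇒> r′≰s)) ⟩
              N ℕ.+ r′            ∎)))
            where open ℕP.≤-Reasoning
          falling≡0 : falling (+ s - + r′) s ≡ 0ℤ
          falling≡0 = trans (cong (λ z → falling z s) (trans (ℤP.m-n≡m⊖n s r′) (ℤP.⊖-≥ r′≤s)))
                            (falling-below (s ∸ r′) s (ℕP.∸-monoʳ-< {s} {r′} {0} (ℕP.n≢0⇒n>0 r′≢0) r′≤s))

        RHS₁-coeff : ∀ k → RHS₁ k ≡ - falling (+ s - + r′) s * w (suc n) c k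
        RHS₁-coeff k = begin
            RHS₁ k
          ≡⟨ *X^ (C a *P (X+1 ^P r′)) c k ⟩
            shift c (C a *P (X+1 ^P r′)) k
          ≡⟨ shift-cong c (λ t → trans (C* a (X+1 ^P r′) t) (cong (a *_) (X+1^-coeff r′ t))) k ⟩
            shift c (λ t → a * + binom r′ t) k
          ≡⟨ shift-scale c a (binomPoly r′) k ⟩
            a * shift c (binomPoly r′) k
          ≡⟨ cong (λ q → a * shift c (binomPoly q) k) (sym (ℕP.m∸[m∸n]≡n (ℕP.<⇒≤ r′<p))) ⟩
            a * w (suc n) c k ∎
          where
          open ≡-Reasoning
          a = - falling (+ s - + r′) s

        LHS≋RHS₁ : ∀ k → LHS k ≋ RHS₁ k
        LHS≋RHS₁ k =
          LHS k
            ≋⟨ LHS≋root-term c c<p (inj₂ c+r′≡p) k ⟩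
          - (α s N c * w (suc n) c k)
            ≋⟨ ≋-neg (≋-*ʳ (w (suc n) c k) α≋falling) ⟩
          - (falling (+ s - + r′) s * w (suc n) c k)
            ≡⟨ trans (ℤP.neg-distribˡ-* (falling (+ s - + r′) s) (w (suc n) c k)) (sym (RHS₁-coeff k)) ⟩≋
          RHS₁ k ∎≋

      -- r′ = 0: the root is c = 0, α_0 = s!, and w_0 = (x+1)^p ≡ x^p + 1.
      module ZeroResidue (r′≡0 : r′ ≡ 0) where
        α₀ : α s N 0 ≡ + (s !)
        α₀ rewrite binom-0 N = ℤP.*-identityʳ (+ (s !))

        w₀≋x^p+1 : ∀ k → w (suc n) 0 k ≋ (X^ (suc n) +P C (+ 1)) k
        w₀≋x^p+1 zero = ≋-refl
        w₀≋x^p+1 (suc k) with ℕP.<-cmp k n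
        ... | tri< k<n k≢n _ rewrite ≡ᵇ-false (λ n≡k → k≢n (sym n≡k)) = ∣⇒≋0 (binom-prime (suc k) (s≤s z≤n) (s≤s k<n))
        ... | tri≈ _ refl _ rewrite ≡ᵇ-true (refl {x = k}) = ≋-reflexive (cong +_ (binom-diag (suc k)))
        ... | tri> _ k≢n n<k rewrite ≡ᵇ-false (λ n≡k → k≢n (sym n≡k)) | binom-above (suc n) (suc k) (s≤s n<k) = ≋-refl

        LHS≋RHS₂ : ∀ k → LHS k ≋ RHS₂ k
        LHS≋RHS₂ k =
          LHS k
            ≋⟨ LHS≋root-term 0 (s≤s z≤n) (inj₁ r′≡0) k ⟩
          - (α s N 0 * w (suc n) 0 k)
            ≡⟨ cong (λ z → - (z * w (suc n) 0 k)) α₀ ⟩≋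
          - (+ (s !) * w (suc n) 0 k)
            ≋⟨ ≋-neg (≋-*ˡ (+ (s !)) (w₀≋x^p+1 k)) ⟩
          - (+ (s !) * (X^ (suc n) +P C (+ 1)) k)
            ≡⟨ trans (ℤP.neg-distribˡ-* (+ (s !)) ((X^ (suc n) +P C (+ 1)) k)) (sym (C* (- (+ (s !))) (X^ (suc n) +P C (+ 1)) k)) ⟩≋
          RHS₂ k ∎≋

    -- The two congruences, as stated (Defs._≡P_[mod_] is unsigned divisibility).
    congruence₁ : r′ ≢ 0 → LHS ≡P RHS₁ [mod suc n ]
    congruence₁ r′≢0 k with s ℕ.<? suc n
    ... | yes s<p = ∣⇒∣ᵤ (get (SmallS.NonzeroResidue.LHS≋RHS₁ s<p r′≢0 k))
    ... | no s≮p = ∣⇒∣ᵤ (get (≋-trans (LHS≋0 k) (≋-sym (RHS₁≋0 k))))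
      where open LargeS (ℕP.≮⇒≥ s≮p)

    congruence₂ : r′ ≡ 0 → LHS ≡P RHS₂ [mod suc n ]
    congruence₂ r′≡0 k with s ℕ.<? suc n
    ... | yes s<p = ∣⇒∣ᵤ (get (SmallS.ZeroResidue.LHS≋RHS₂ s<p r′≡0 k))
    ... | no s≮p = ∣⇒∣ᵤ (get (≋-trans (LHS≋0 k) (≋-sym (RHS₂≋0 k))))
      where open LargeS (ℕP.≮⇒≥ s≮p)

open import Data.Nat using (ℕ; zero; suc; _≤_; _<_; _+_; _*_; _∸_; _!)
open import Data.Nat.Primality using (Prime)
open import Data.Integer using (+_; -_; _-_)
open import Data.Integer.Divisibility using (_∣_)
open import Data.Integer.Divisibility.Signed using (∣ᵤ⇒∣)
open import Data.Product using (_×_; _,_)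
open import Relation.Binary.PropositionalEquality using (_≡_; _≢_)

-- p = 0 is excluded by r′ < p; for p = n + 1 both congruences come from
-- FModP.Corollary.
corollary12 : (m r s p r′ : ℕ) → 1 ≤ m → Prime p → r′ < p → (+ p) ∣ (+ r - + r′) →
    ((r′ ≢ 0) →
      ((X+1 ^P (s + 1)) *P (F (m * (p ∸ 1)) r s -P C (+ (s !))))
        ≡P ((C (- falling (+ s - + r′) s) *P (X+1 ^P r′)) *P X^ (p ∸ r′)) [mod p ])
    × ((r′ ≡ 0) →
      ((X+1 ^P (s + 1)) *P (F (m * (p ∸ 1)) r s -P C (+ (s !))))
        ≡P (C (- (+ (s !))) *P (X^ p +P C (+ 1))) [mod p ])
corollary12 m r s zero r′ _ _ () _
corollary12 m r s (suc n) r′ 1≤m isPrime r′<p p∣r-r′ = congruence₁ , congruence₂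
  where open FModP.Corollary n isPrime m r s r′ 1≤m r′<p (∣ᵤ⇒∣ p∣r-r′)
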